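{- Let $k\in\{1,2,\dots,\frac{\ell mn}{L}\}$. If $(u_1,v_i,w_j)=s_k$ and $(u_1,v_y,w_z)$ is any row of $A^{(k)}$, then $y\equiv i\pmod{\gcd(\ell,m)}$.
   Context: Let $\ell,m,n\geq 2$ be integers, $L=\mathrm{lcm}(\ell,m,n)$ and $\lambda=\frac{n\cdot\mathrm{lcm}(\ell,m)}{L}$. Write $V(K_\ell)=\{u_1,\dots,u_\ell\}$, $V(K_m)=\{v_1,\dots,v_m\}$, $V(K_n)=\{w_1,\dots,w_n\}$, so vertices of $K_\ell\square K_m\square K_n$ are triples $(u_a,v_b,w_c)$. Let $\rho=(u_1\,u_2\,\cdots\,u_\ell)$, $\sigma=(v_1\,v_2\,\cdots\,v_m)$, $\tau=(w_1\,w_2\,\cdots\,w_n)$ be the cyclic permutations of the respective vertex sets. Define $L\times 3$ matrices $A^{(k)}=[\mathbf{c}^{(k)}\ \mathbf{d}^{(k)}\ \mathbf{e}^{(k)}]$ (columns) for $k=1,\dots,\frac{\ell mn}{L}$ as follows: row $r$ ($r=1,\dots,L$) of $A^{(1)}$ is $(\rho^{r-1}(u_1),\sigma^{r-1}(v_1),\tau^{r-1}(w_1))$; for $k>1$, $\mathbf{c}^{(k)}=\mathbf{c}^{(1)}$, and if $k\equiv 1\pmod{\lambda}$ then $\mathbf{d}^{(k)}=\sigma(\mathbf{d}^{(k-1)})$, $\mathbf{e}^{(k)}=\mathbf{e}^{(k-1)}$, while otherwise $\mathbf{d}^{(k)}=\mathbf{d}^{(k-1)}$, $\mathbf{e}^{(k)}=\tau(\mathbf{e}^{(k-1)})$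 (permutations applied entrywise). Each row is regarded as a vertex of $K_\ell\square K_m\square K_n$. The seed $s_k$ is the first row of $A^{(k)}$. -}

module Defs where

open import Data.Nat using (ℕ; zero; suc; _+_; _*_; _∸_; _/_; _<ᵇ_; NonZero; ≢-nonZero; ≢-nonZero⁻¹)
open import Data.Nat.Properties using (m*n≢0; *-zeroʳ)
open import Data.Nat.LCM using (lcm; gcd*lcm)
open import Data.Nat.Divisibility using (_∣?_)
open import Data.Bool using (if_then_else_)
open import Data.Product using (_×_; _,_)
open import Relation.Nullary using (does)
open import Relation.Binary.PropositionalEquality using (_≡_; refl; cong; sym; trans)

-- Vertices u_a, v_b, w_c are encoded by their 1-based indices a, b, c.
-- Cyclic permutation (x_1 x_2 ... x_p) acting on 1-based indices 1..p:
-- x_a ↦ x_{a+1} for a < p, and x_p ↦ x_1.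
cyc : ℕ → ℕ → ℕ
cyc p a = if a <ᵇ p then suc a else 1

iter : (ℕ → ℕ) → ℕ → ℕ → ℕ
iter f zero    x = x
iter f (suc k) x = f (iter f k x)

lcm-nonZero : ∀ a b → .{{NonZero a}} → .{{NonZero b}} → NonZero (lcm a b)
lcm-nonZero a b = ≢-nonZero λ eq →
  ≢-nonZero⁻¹ (a * b) {{m*n≢0 a b}}
    (trans (sym (gcd*lcm a b)) (trans (cong (Data.Nat.GCD.gcd a b *_) eq) (*-zeroʳ (Data.Nat.GCD.gcd a b))))
  where import Data.Nat.GCD

Lcm3 : ℕ → ℕ → ℕ → ℕ
Lcm3 ℓ m n = lcm (lcm ℓ m) n

Lcm3-nonZero : ∀ ℓ m n → .{{NonZero ℓ}} → .{{NonZero m}} → .{{NonZero n}} → NonZero (Lcm3 ℓ m n)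
Lcm3-nonZero ℓ m n = lcm-nonZero (lcm ℓ m) n {{lcm-nonZero ℓ m}}

lam : (ℓ m n : ℕ) → .{{NonZero ℓ}} → .{{NonZero m}} → .{{NonZero n}} → ℕ
lam ℓ m n = _/_ (n * lcm ℓ m) (Lcm3 ℓ m n) {{Lcm3-nonZero ℓ m n}}

numMat : (ℓ m n : ℕ) → .{{NonZero ℓ}} → .{{NonZero m}} → .{{NonZero n}} → ℕ
numMat ℓ m n = _/_ (ℓ * m * n) (Lcm3 ℓ m n) {{Lcm3-nonZero ℓ m n}}

-- Column c^(k) (independent of k), entry in row r (1-based): ρ^{r-1}(u_1)
colC : (ℓ r : ℕ) → ℕ
colC ℓ r = iter (cyc ℓ) (r ∸ 1) 1

-- colD ... j r / colE ... j r : entry in row r of d^(j+1) / e^(j+1).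
-- Step from A^(k-1) to A^(k) with k = j + 2: k ≡ 1 (mod λ) iff λ ∣ k - 1 = suc j.
colD : (ℓ m n : ℕ) → .{{NonZero ℓ}} → .{{NonZero m}} → .{{NonZero n}} → ℕ → ℕ → ℕ
colD ℓ m n zero    r = iter (cyc m) (r ∸ 1) 1
colD ℓ m n (suc j) r =
  if does (lam ℓ m n ∣? suc j) then cyc m (colD ℓ m n j r) else colD ℓ m n j r

colE : (ℓ m n : ℕ) → .{{NonZero ℓ}} → .{{NonZero m}} → .{{NonZero n}} → ℕ → ℕ → ℕ
colE ℓ m n zero    r = iter (cyc n) (r ∸ 1) 1
colE ℓ m n (suc j) r =
  if does (lam ℓ m n ∣? suc j) then colE ℓ m n j r else cyc n (colE ℓ m n j r)

-- Row r (1 ≤ r ≤ L) of A^(k) (1 ≤ k ≤ ℓmn/L), as the triple of indices (a,b,c) of (u_a,v_b,w_c)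
row : (ℓ m n : ℕ) → .{{NonZero ℓ}} → .{{NonZero m}} → .{{NonZero n}} → (k r : ℕ) → ℕ × ℕ × ℕ
row ℓ m n k r = colC ℓ r , colD ℓ m n (k ∸ 1) r , colE ℓ m n (k ∸ 1) r

seed : (ℓ m n : ℕ) → .{{NonZero ℓ}} → .{{NonZero m}} → .{{NonZero n}} → ℕ → ℕ × ℕ × ℕ
seed ℓ m n k = row ℓ m n k 1

-- Row r of A^(k) has b-index 1 + ((r − 1) + t) mod m, where t counts the σ-steps made
-- before A^(k), while its seed has b-index 1 + t mod m.  If the row lies in the u_1-layer
-- then ℓ ∣ r − 1, so gcd(ℓ,m) divides both r − 1 and m, and the two b-indices agree
-- modulo gcd(ℓ,m).
module Submission where

open import Defs
open import Data.Nat using (ℕ; _*_; _≤_; NonZero)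
open import Data.Nat.GCD using (gcd)
open import Data.Integer using (+_; _-_)
open import Data.Integer.Divisibility using (_∣_)
open import Data.Product using (_,_)
open import Relation.Binary.PropositionalEquality using (_≡_)

open import Data.Bool using (true; false; if_then_else_)
open import Data.Nat using (suc; zero; _+_; _∸_; _%_; _/_; _<ᵇ_; ≢-nonZero; ≢-nonZero⁻¹)
open import Data.Nat.Properties using (<ᵇ-reflects-<; ≤-antisym; ≮⇒≥; +-identityʳ; +-suc; suc-injective)
open import Data.Nat.DivMod
  using (m≡m%n+[m/n]*n; m%n<n; m<n⇒m%n≡m; n%n≡0; %-congˡ; %-distribˡ-+; %-remove-+ˡ; m∣n⇒o%n%m≡o%m)
import Data.Nat.Divisibility as ℕ
open import Data.Nat.GCD using (gcd[m,n]∣m; gcd[m,n]∣n; gcd[m,n]≢0)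
import Data.Integer as ℤ
open import Data.Integer.Properties using (pos-+; pos-*)
open import Data.Integer.Divisibility.Signed using (divides; ∣⇒∣ᵤ)
open import Data.Integer.Tactic.RingSolver using (solve-∀)
open import Data.Product using (proj₁; proj₂)
open import Function using (_∘_)
open import Data.Sum using (inj₂)
open import Relation.Nullary using (does)
open import Relation.Nullary.Reflects using (ofʸ; ofⁿ)
open import Relation.Binary.PropositionalEquality using (refl; sym; trans; cong; cong₂; module ≡-Reasoning)

open ≡-Reasoning

[1+m%n]%d≡[1+m]%d : ∀ m {n d} .{{_ : NonZero n}} .{{_ : NonZero d}} →
  d ℕ.∣ n → suc (m % n) % d ≡ suc m % d
[1+m%n]%d≡[1+m]%d m {n} {d} d∣n = begin
  (1 + m % n) % d          ≡⟨ %-distribˡ-+ 1 (m % n) d ⟩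
  (1 % d + m % n % d) % d  ≡⟨ cong (λ x → (1 % d + x) % d) (m∣n⇒o%n%m≡o%m d n m d∣n) ⟩
  (1 % d + m % d) % d      ≡⟨ %-distribˡ-+ 1 m d ⟨
  (1 + m) % d              ∎

cyc≡1+% : ∀ p .{{_ : NonZero p}} {b} → b ≤ p → cyc p b ≡ suc (b % p)
cyc≡1+% p {b} b≤p with b <ᵇ p | <ᵇ-reflects-< b p
... | true  | ofʸ b<p = cong suc (sym (m<n⇒m%n≡m b<p))
... | false | ofⁿ b≮p = cong suc (sym (trans (%-congˡ (≤-antisym b≤p (≮⇒≥ b≮p))) (n%n≡0 p)))

iter-cyc-1 : ∀ p .{{_ : NonZero p}} a → iter (cyc p) a 1 ≡ suc (a % p)
iter-cyc-1 p@(suc _) zero    = refl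
iter-cyc-1 p         (suc a) = begin
  cyc p (iter (cyc p) a 1)  ≡⟨ cong (cyc p) (iter-cyc-1 p a) ⟩
  cyc p (suc (a % p))       ≡⟨ cyc≡1+% p (m%n<n a p) ⟩
  suc (suc (a % p) % p)     ≡⟨ cong suc ([1+m%n]%d≡[1+m]%d a (ℕ.∣-refl {p})) ⟩
  suc (suc a % p)           ∎

σ-steps : (ℓ m n : ℕ) → .{{NonZero ℓ}} → .{{NonZero m}} → .{{NonZero n}} → ℕ → ℕ
σ-steps ℓ m n zero    = 0
σ-steps ℓ m n (suc j) =
  if does (lam ℓ m n ℕ.∣? suc j) then suc (σ-steps ℓ m n j) else σ-steps ℓ m n j

colD≡1+% : (ℓ m n : ℕ) → .{{_ : NonZero ℓ}} → .{{_ : NonZero m}} → .{{_ : NonZero n}} →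
  ∀ j r → colD ℓ m n j r ≡ suc ((r ∸ 1 + σ-steps ℓ m n j) % m)
colD≡1+% ℓ m n zero r = begin
  iter (cyc m) (r ∸ 1) 1       ≡⟨ iter-cyc-1 m (r ∸ 1) ⟩
  suc ((r ∸ 1) % m)            ≡⟨ cong (λ x → suc (x % m)) (sym (+-identityʳ (r ∸ 1))) ⟩
  suc ((r ∸ 1 + 0) % m)        ∎
colD≡1+% ℓ m n (suc j) r with does (lam ℓ m n ℕ.∣? suc j)
... | true  = begin
  cyc m (colD ℓ m n j r)                      ≡⟨ cong (cyc m) (colD≡1+% ℓ m n j r) ⟩
  cyc m (suc ((r ∸ 1 + t) % m))               ≡⟨ cyc≡1+% m (m%n<n (r ∸ 1 + t) m) ⟩
  suc (suc ((r ∸ 1 + t) % m) % m)             ≡⟨ cong suc ([1+m%n]%d≡[1+m]%d (r ∸ 1 + t) (ℕ.∣-refl {m})) ⟩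
  suc (suc (r ∸ 1 + t) % m)                   ≡⟨ cong (λ x → suc (x % m)) (+-suc (r ∸ 1) t) ⟨
  suc ((r ∸ 1 + suc t) % m)                   ∎
  where
  t : ℕ
  t = σ-steps ℓ m n j
... | false = colD≡1+% ℓ m n j r

colC≡1⇒∣ : ∀ ℓ .{{_ : NonZero ℓ}} r → colC ℓ r ≡ 1 → ℓ ℕ.∣ r ∸ 1
colC≡1⇒∣ ℓ r c≡1 = ℕ.m%n≡0⇒n∣m (r ∸ 1) ℓ (suc-injective (trans (sym (iter-cyc-1 ℓ (r ∸ 1))) c≡1))

%-≡⇒∣- : ∀ d .{{_ : NonZero d}} a b → a % d ≡ b % d → (+ d) ∣ (+ a - + b)
%-≡⇒∣- d a b a≡b = ∣⇒∣ᵤ (divides (+ (a / d) - + (b / d)) (begin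
  + a - + b                                ≡⟨ cong₂ _-_ (split a) (split b) ⟩
  (+ (a % d) ℤ.+ A ℤ.* D) - (+ (b % d) ℤ.+ B ℤ.* D)
                                           ≡⟨ cong (λ x → (+ x ℤ.+ A ℤ.* D) - (+ (b % d) ℤ.+ B ℤ.* D)) a≡b ⟩
  (+ (b % d) ℤ.+ A ℤ.* D) - (+ (b % d) ℤ.+ B ℤ.* D)
                                           ≡⟨ cancel (+ (b % d)) A B D ⟩
  (A - B) ℤ.* D                            ∎))
  where
  A B D : ℤ.ℤ
  A = + (a / d)
  B = + (b / d)
  D = + d
  split : ∀ x → + x ≡ + (x % d) ℤ.+ + (x / d) ℤ.* D
  split x = begin
    + x                                 ≡⟨ cong +_ (m≡m%n+[m/n]*n x d) ⟩
    + (x % d + x / d * d)               ≡⟨ pos-+ (x % d) (x / d * d) ⟩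
    + (x % d) ℤ.+ + (x / d * d)         ≡⟨ cong (λ e → + (x % d) ℤ.+ e) (pos-* (x / d) d) ⟩
    + (x % d) ℤ.+ + (x / d) ℤ.* D       ∎
  cancel : ∀ R A B D → (R ℤ.+ A ℤ.* D) - (R ℤ.+ B ℤ.* D) ≡ (A - B) ℤ.* D
  cancel = solve-∀

row-b-index : (ℓ m n : ℕ) → .{{_ : NonZero ℓ}} → .{{_ : NonZero m}} → .{{_ : NonZero n}} →
  ∀ k r {a b c} → row ℓ m n k r ≡ (a , b , c) → b ≡ suc ((r ∸ 1 + σ-steps ℓ m n (k ∸ 1)) % m)
row-b-index ℓ m n k r row≡ = trans (sym (cong (proj₁ ∘ proj₂) row≡)) (colD≡1+% ℓ m n (k ∸ 1) r)

mainTheorem7 : (ℓ m n : ℕ) → .{{_ : NonZero ℓ}} → .{{_ : NonZero m}} → .{{_ : NonZero n}} →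
    2 ≤ ℓ → 2 ≤ m → 2 ≤ n →
    (k : ℕ) → 1 ≤ k → k ≤ numMat ℓ m n →
    (i j : ℕ) → seed ℓ m n k ≡ (1 , i , j) →
    (r : ℕ) → 1 ≤ r → r ≤ Lcm3 ℓ m n →
    (y z : ℕ) → row ℓ m n k r ≡ (1 , y , z) →
    (+ gcd ℓ m) ∣ (+ y - + i)
mainTheorem7 ℓ m n _ _ _ k _ _ i _ seed≡ r _ _ y _ row≡ = %-≡⇒∣- g y i (begin
  y % g                       ≡⟨ cong (_% g) (row-b-index ℓ m n k r row≡) ⟩
  suc ((r ∸ 1 + t) % m) % g   ≡⟨ [1+m%n]%d≡[1+m]%d (r ∸ 1 + t) g∣m ⟩
  suc (r ∸ 1 + t) % g         ≡⟨ cong (_% g) (+-suc (r ∸ 1) t) ⟨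
  (r ∸ 1 + suc t) % g         ≡⟨ %-remove-+ˡ (suc t) g∣r-1 ⟩
  suc t % g                   ≡⟨ [1+m%n]%d≡[1+m]%d t g∣m ⟨
  suc (t % m) % g             ≡⟨ cong (_% g) (row-b-index ℓ m n k 1 seed≡) ⟨
  i % g                       ∎)
  where
  g t : ℕ
  g = gcd ℓ m
  t = σ-steps ℓ m n (k ∸ 1)
  instance
    g≢0 : NonZero g
    g≢0 = ≢-nonZero (gcd[m,n]≢0 ℓ m (inj₂ (≢-nonZero⁻¹ m)))
  g∣m : g ℕ.∣ m
  g∣m = gcd[m,n]∣n ℓ m
  g∣r-1 : g ℕ.∣ r ∸ 1
  g∣r-1 = ℕ.∣-trans (gcd[m,n]∣m ℓ m) (colC≡1⇒∣ ℓ r (cong proj₁ row≡))
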